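{- If $(X,\tau,\sigma)$ is a pairwise Balbes-Dwinger space, then the set $\mathfrak{E}(X)$ of essential subsets of $X$, ordered by inclusion, is a lattice in which $A\vee B=A\cup B$ and $A\wedge B=i(d(A\cap B))$.
   Context: For a topology $\rho$, $p\sqsubseteq_\rho q$ means every $\rho$-open set containing $p$ contains $q$. For $(X,\tau,\sigma)$: $i(B)=\{p:\exists b\in B,\ b\sqsubseteq_\tau p\}$, $d(A)=\{p:\forall q\,(p\sqsubseteq_\sigma q\Rightarrow q\in A)\}$; $A$ is stable if $\sqsubseteq_\tau$-upward closed with $i(d(A))=A$. A nonempty $A$ is essential if $\tau$-compact, $d(A)$ $\sigma$-open and $A$ stable; $\emptyset$ is essential if every family of $\sigma$-compact $\sigma$-open sets with the finite intersection property has nonempty intersection. A pairwise Balbes-Dwinger space is $(X,\tau,\sigma)$ with: (i) pairwise $T_0$ (for $p\neq q$ there is a $\tau$-open set containing $p$ not $q$, or a $\sigma$-open set containing $q$ not $p$); (ii) essential sets form a subbasis of $\tau$; (iii) $\{d(A):A$ essential$\}$ is a basis of $\sigma$ closed under finite intersections; (iv) for essential $A,B$, $A\cup B$ and $i(d(A\cap B))$ are essential; (v) if nonempty families $V,W$ of essential sets satisfy $\bigcap_{A\in V}d(A)\subseteq\bigcup_{B\in W}B$, then finite nonempty subfamilies satisfy the same inclusion. -}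

module Defs where

open import Level using (0ℓ)
open import Data.Product using (Σ; ∃; _×_; _,_; proj₁; proj₂)
open import Data.Sum using (_⊎_)
open import Data.List using (List)
open import Data.List.NonEmpty using (List⁺; toList)
open import Data.List.Relation.Unary.All using (All)
open import Data.List.Relation.Unary.Any using (Any)
open import Relation.Nullary using (¬_)
open import Relation.Unary using (Pred; _⊆_; _∩_; _∪_; ∅; U)
open import Relation.Binary.PropositionalEquality using (_≡_)
open import Relation.Binary.Lattice.Structures using (IsLattice)

_≐_ : {X : Set} → Pred X 0ℓ → Pred X 0ℓ → Set
A ≐ B = (A ⊆ B) × (B ⊆ A)

-- A topology on X.  To stay in a small universe, the open sets are given
-- by an index type 'O' together with the subset each index denotes.
record Topology (X : Set) : Set₁ where
  field
    O          : Set
    ⟦_⟧        : O → Pred X 0ℓ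
    open-empty : ∃ λ o → ⟦ o ⟧ ≐ ∅
    open-full  : ∃ λ o → ⟦ o ⟧ ≐ U
    open-∩     : ∀ o o′ → ∃ λ o″ → ⟦ o″ ⟧ ≐ (⟦ o ⟧ ∩ ⟦ o′ ⟧)
    open-⋃     : (I : Set) (F : I → O) →
                 ∃ λ o → ⟦ o ⟧ ≐ (λ x → ∃ λ j → ⟦ F j ⟧ x)
open Topology public

module _ {X : Set} where

  Open : Topology X → Pred X 0ℓ → Set
  Open ρ A = ∃ λ o → ⟦_⟧ ρ o ≐ A

  _⊑[_]_ : X → Topology X → X → Set
  p ⊑[ ρ ] q = ∀ (o : O ρ) → ⟦_⟧ ρ o p → ⟦_⟧ ρ o q

  Compact : Topology X → Pred X 0ℓ → Set₁
  Compact ρ A = (I : Set) (F : I → Pred X 0ℓ) → (∀ j → Open ρ (F j)) →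
    A ⊆ (λ x → ∃ λ j → F j x) →
    Σ (List I) λ js → A ⊆ (λ x → Any (λ j → F j x) js)

  Nonempty : Pred X 0ℓ → Set
  Nonempty A = ∃ λ p → A p

  FIP : {I : Set} → (I → Pred X 0ℓ) → Set
  FIP {I} F = (js : List I) → ∃ λ x → All (λ j → F j x) js

  module BiOps (τ σ : Topology X) where

    i : Pred X 0ℓ → Pred X 0ℓ
    i B p = ∃ λ b → B b × (b ⊑[ τ ] p)

    d : Pred X 0ℓ → Pred X 0ℓ
    d A p = ∀ q → p ⊑[ σ ] q → A q

    UpClosed : Pred X 0ℓ → Set
    UpClosed A = ∀ p q → A p → p ⊑[ τ ] q → A q

    Stable : Pred X 0ℓ → Set
    Stable A = UpClosed A × (i (d A) ≐ A)

    EmptyCond : Set₁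
    EmptyCond = (I : Set) (F : I → Pred X 0ℓ) →
      (∀ j → Compact σ (F j) × Open σ (F j)) → FIP F →
      ∃ λ x → ∀ j → F j x

    Essential : Pred X 0ℓ → Set₁
    Essential A =
        (Nonempty A × Compact τ A × Open σ (d A) × Stable A)
      ⊎ (A ≐ ∅ × EmptyCond)

    Ess : Set₁
    Ess = Σ (Pred X 0ℓ) Essential

    ⋂⁺ : {I : Set} → (I → Pred X 0ℓ) → List⁺ I → Pred X 0ℓ
    ⋂⁺ F js x = All (λ j → F j x) (toList js)

    ⋃⁺ : {I : Set} → (I → Pred X 0ℓ) → List⁺ I → Pred X 0ℓ
    ⋃⁺ F js x = Any (λ j → F j x) (toList js)

  record PairwiseBD (τ σ : Topology X) : Set₁ where
    open BiOps τ σ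
    field
      pairwiseT0 : ∀ p q → ¬ (p ≡ q) →
        (∃ λ o → ⟦_⟧ τ o p × ¬ ⟦_⟧ τ o q) ⊎ (∃ λ o → ⟦_⟧ σ o q × ¬ ⟦_⟧ σ o p)
      ess-τ-open : ∀ A → Essential A → Open τ A
      ess-subbasis : ∀ (o : O τ) p → ⟦_⟧ τ o p →
        Σ (List Ess) λ As →
          All (λ E → proj₁ E p) As ×
          (∀ x → All (λ E → proj₁ E x) As → ⟦_⟧ τ o x)
      d-σ-open : ∀ A → Essential A → Open σ (d A)
      d-basis : ∀ (o : O σ) p → ⟦_⟧ σ o p →
        ∃ λ (E : Ess) → d (proj₁ E) p × d (proj₁ E) ⊆ ⟦_⟧ σ o
      d-∩ : ∀ A B → Essential A → Essential B →
        ∃ λ (E : Ess) → d (proj₁ E) ≐ (d A ∩ d B)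
      ess-∪ : ∀ A B → Essential A → Essential B → Essential (A ∪ B)
      ess-idm : ∀ A B → Essential A → Essential B → Essential (i (d (A ∩ B)))
      compactness : (I J : Set) → I → J →
        (V : I → Pred X 0ℓ) (W : J → Pred X 0ℓ) →
        (∀ j → Essential (V j)) → (∀ j → Essential (W j)) →
        (λ x → ∀ j → d (V j) x) ⊆ (λ x → ∃ λ j → W j x) →
        Σ (List⁺ I) λ is → Σ (List⁺ J) λ js →
          ⋂⁺ (λ j → d (V j)) is ⊆ ⋃⁺ W js

  module EssLattice {τ σ : Topology X} (BD : PairwiseBD τ σ) where
    open BiOps τ σ
    open PairwiseBD BD

    _≈E_ : Ess → Ess → Set
    E ≈E F = proj₁ E ≐ proj₁ F

    _⊆E_ : Ess → Ess → Set
    E ⊆E F = proj₁ E ⊆ proj₁ F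

    _∨E_ : Ess → Ess → Ess
    (A , eA) ∨E (B , eB) = (A ∪ B) , ess-∪ A B eA eB

    _∧E_ : Ess → Ess → Ess
    (A , eA) ∧E (B , eB) = i (d (A ∩ B)) , ess-idm A B eA eB

EssIsLattice : {X : Set} {τ σ : Topology X} → PairwiseBD τ σ → Set₁
EssIsLattice BD = IsLattice _≈E_ _⊆E_ _∨E_ _∧E_
  where open EssLattice BD

{-# OPTIONS --safe #-}
module Submission where

open import Defs
open import Level using (0ℓ)
open import Function using (_∘_)
open import Data.Product using (_,_; proj₁; proj₂; <_,_>)
open import Data.Sum using (inj₁; inj₂; [_,_])
open import Data.Empty using (⊥-elim)
open import Relation.Unary using (Pred; _⊆_; _∩_; _∪_)
open import Relation.Unary.Properties using (≐-refl; ≐-sym; ≐-trans; ⊆-reflexive; ⊆-trans; ⊆-antisym)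
open import Relation.Binary.Structures using (IsPartialOrder)
open import Relation.Binary.Lattice.Definitions using (Supremum; Infimum)
import Relation.Binary.Construct.On as On

-- The lattice laws are inclusion facts about subsets; essentiality enters only
-- through the two consequences that an essential set is ⊑τ-upward closed and
-- satisfies A ⊆ i (d A) (vacuously so for the empty essential set).

⊆-isPartialOrder : {X : Set} → IsPartialOrder {A = Pred X 0ℓ} _≐_ _⊆_
⊆-isPartialOrder = record
  { isPreorder = record
    { isEquivalence = record { refl = ≐-refl ; sym = ≐-sym ; trans = ≐-trans }
    ; reflexive     = ⊆-reflexive
    ; trans         = ⊆-trans
    }
  ; antisym = ⊆-antisym
  }

∪-supremum : {X : Set} → Supremum {A = Pred X 0ℓ} _⊆_ _∪_
∪-supremum A B = inj₁ , inj₂ , λ C A⊆C B⊆C → [ A⊆C , B⊆C ]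

⊑-refl : {X : Set} (ρ : Topology X) {p : X} → p ⊑[ ρ ] p
⊑-refl ρ o p∈o = p∈o

module _ {X : Set} (τ σ : Topology X) where
  open BiOps τ σ

  d-deflationary : {A : Pred X 0ℓ} → d A ⊆ A
  d-deflationary {x = p} p∈dA = p∈dA p (⊑-refl σ)

  d-mono : {A B : Pred X 0ℓ} → A ⊆ B → d A ⊆ d B
  d-mono A⊆B p∈dA q p⊑q = A⊆B (p∈dA q p⊑q)

  i-mono : {A B : Pred X 0ℓ} → A ⊆ B → i A ⊆ i B
  i-mono A⊆B (b , b∈A , b⊑p) = b , A⊆B b∈A , b⊑p

  i-upClosed⊆ : {A : Pred X 0ℓ} → UpClosed A → i A ⊆ A
  i-upClosed⊆ up (b , b∈A , b⊑p) = up b _ b∈A b⊑p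

  essential⇒upClosed : {A : Pred X 0ℓ} → Essential A → UpClosed A
  essential⇒upClosed (inj₁ (_ , _ , _ , up , _)) = up
  essential⇒upClosed (inj₂ (A≐∅ , _))            = λ p _ p∈A _ → ⊥-elim (proj₁ A≐∅ p∈A)

  essential⇒⊆i∘d : {A : Pred X 0ℓ} → Essential A → A ⊆ i (d A)
  essential⇒⊆i∘d (inj₁ (_ , _ , _ , _ , _ , A⊆idA)) = A⊆idA
  essential⇒⊆i∘d (inj₂ (A≐∅ , _))                  = ⊥-elim ∘ proj₁ A≐∅

  i∘d∩-lowerˡ : {A B : Pred X 0ℓ} → UpClosed A → i (d (A ∩ B)) ⊆ A
  i∘d∩-lowerˡ up = i-upClosed⊆ up ∘ i-mono (proj₁ ∘ d-deflationary)

  i∘d∩-lowerʳ : {A B : Pred X 0ℓ} → UpClosed B → i (d (A ∩ B)) ⊆ B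
  i∘d∩-lowerʳ up = i-upClosed⊆ up ∘ i-mono (proj₂ ∘ d-deflationary)

  i∘d∩-greatest : {A B C : Pred X 0ℓ} → C ⊆ i (d C) → C ⊆ A → C ⊆ B → C ⊆ i (d (A ∩ B))
  i∘d∩-greatest C⊆idC C⊆A C⊆B = i-mono (d-mono < C⊆A , C⊆B >) ∘ C⊆idC

module _ {X : Set} {τ σ : Topology X} (BD : PairwiseBD τ σ) where
  open BiOps τ σ
  open EssLattice BD

  ⊆E-isPartialOrder : IsPartialOrder _≈E_ _⊆E_
  ⊆E-isPartialOrder = On.isPartialOrder proj₁ ⊆-isPartialOrder

  ∨E-supremum : Supremum _⊆E_ _∨E_
  ∨E-supremum (A , _) (B , _) =
    let A⊆A∪B , B⊆A∪B , least = ∪-supremum A B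
    in A⊆A∪B , B⊆A∪B , λ C → least (proj₁ C)

  ∧E-infimum : Infimum _⊆E_ _∧E_
  ∧E-infimum (A , eA) (B , eB) =
      i∘d∩-lowerˡ τ σ (essential⇒upClosed τ σ eA)
    , i∘d∩-lowerʳ τ σ (essential⇒upClosed τ σ eB)
    , λ (C , eC) → i∘d∩-greatest τ σ (essential⇒⊆i∘d τ σ eC)

mainTheorem19 : {X : Set} (τ σ : Topology X) (BD : PairwiseBD τ σ) →
    EssIsLattice BD
mainTheorem19 τ σ BD = record
  { isPartialOrder = ⊆E-isPartialOrder BD
  ; supremum       = ∨E-supremum BD
  ; infimum        = ∧E-infimum BD
  }
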